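{- Let $G$ be a graph on $n$ vertices with independence number $\alpha(G)=2$. Then $\operatorname{lcc}(G)+\operatorname{lcc}(\overline{G})\leq n$.
   Context: All graphs are finite, simple and undirected; $\overline{G}$ denotes the complement of $G$. A clique of $G$ is a set of pairwise adjacent vertices. A clique covering of $E(G)$ is a family $\mathcal{C}$ of cliques of $G$ such that every edge of $G$ lies in at least one member of $\mathcal{C}$. For a vertex $v$, its valency $val_{\mathcal{C}}(v)$ is the number of cliques in $\mathcal{C}$ containing $v$. The local clique cover number $\operatorname{lcc}(G)$ is the smallest integer $k$ such that there is a clique covering $\mathcal{C}$ of $E(G)$ with $val_{\mathcal{C}}(v)\le k$ for every vertex $v$ of $G$. -}

module Defs where

open import Data.Nat using (ℕ; _≤_)
open import Data.Bool using (Bool; true; false; not; _∧_; T)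
open import Data.Fin using (Fin; _≟_)
open import Data.Fin.Subset using (Subset; _∈_; ∣_∣)
open import Data.Fin.Subset.Properties using (_∈?_)
open import Data.List using (List; length; filter)
open import Data.List.Relation.Unary.Any using (Any)
open import Data.List.Relation.Unary.All using (All)
open import Data.Product using (_×_; Σ; ∃; _,_)
open import Relation.Nullary using (¬_; ⌊_⌋)
open import Relation.Binary.PropositionalEquality using (_≡_; _≢_)

record Graph (n : ℕ) : Set where
  field
    adj   : Fin n → Fin n → Bool
    adj-sym : ∀ u v → adj u v ≡ adj v u
    adj-irrefl : ∀ v → adj v v ≡ false
open Graph public

Adj : ∀ {n} → Graph n → Fin n → Fin n → Set
Adj G u v = T (adj G u v)

complement : ∀ {n} → Graph n → Graph n
complement {n} G = record
  { adj = λ u v → not (adj G u v) ∧ not ⌊ u ≟ v ⌋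
  ; adj-sym = symC
  ; adj-irrefl = irrC
  }
  where
  open import Relation.Nullary using (yes; no)
  open import Relation.Binary.PropositionalEquality using (refl; sym; trans; cong)
  symC : ∀ u v → (not (adj G u v) ∧ not ⌊ u ≟ v ⌋) ≡ (not (adj G v u) ∧ not ⌊ v ≟ u ⌋)
  symC u v with u ≟ v | v ≟ u
  ... | yes _ | yes _ = trans (Data.Bool.Properties.∧-zeroʳ _) (sym (Data.Bool.Properties.∧-zeroʳ _))
    where import Data.Bool.Properties
  ... | no _  | no _  rewrite Graph.adj-sym G u v = refl
  ... | yes p | no q  = Data.Empty.⊥-elim (q (sym p)) where import Data.Empty
  ... | no p  | yes q = Data.Empty.⊥-elim (p (sym q)) where import Data.Empty
  irrC : ∀ v → (not (adj G v v) ∧ not ⌊ v ≟ v ⌋) ≡ false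
  irrC v with v ≟ v
  ... | yes _ = Data.Bool.Properties.∧-zeroʳ (not (adj G v v))
    where import Data.Bool.Properties
  ... | no q = Data.Empty.⊥-elim (q refl) where import Data.Empty

IsClique : ∀ {n} → Graph n → Subset n → Set
IsClique G C = ∀ u v → u ∈ C → v ∈ C → u ≢ v → Adj G u v

IsIndependent : ∀ {n} → Graph n → Subset n → Set
IsIndependent G S = ∀ u v → u ∈ S → v ∈ S → ¬ Adj G u v

IndependenceNumber : ∀ {n} → Graph n → ℕ → Set
IndependenceNumber {n} G k =
  (Σ (Subset n) λ S → IsIndependent G S × ∣ S ∣ ≡ k) ×
  (∀ (S : Subset n) → IsIndependent G S → ∣ S ∣ ≤ k)

IsCliqueCovering : ∀ {n} → Graph n → List (Subset n) → Set
IsCliqueCovering G 𝒞 =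
  All (IsClique G) 𝒞 ×
  (∀ u v → Adj G u v → Any (λ C → u ∈ C × v ∈ C) 𝒞)

valency : ∀ {n} → List (Subset n) → Fin n → ℕ
valency 𝒞 v = length (filter (λ C → v ∈? C) 𝒞)

LocalCoverBound : ∀ {n} → Graph n → ℕ → Set
LocalCoverBound {n} G k =
  Σ (List (Subset n)) λ 𝒞 → IsCliqueCovering G 𝒞 × (∀ v → valency 𝒞 v ≤ k)

IsLCC : ∀ {n} → Graph n → ℕ → Set
IsLCC G k = LocalCoverBound G k × (∀ j → LocalCoverBound G j → k ≤ j)

-- Let x be a vertex of minimum degree δ. Since α(G) = 2, the vertices outside the closed
-- neighbourhood N[x] form a clique A: two non-adjacent ones would be independent together with x.
-- The edges of G are covered by A, by the stars {b} ∪ (N(b) ∩ A) for b ∈ N(x), and by the single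
-- edges inside N[x]. A vertex of A lies in A and in at most δ stars; a vertex v of N[x] lies in its
-- own star and in one edge per neighbour of v inside N[x], at most |N[x]| = δ + 1 cliques in total.
-- Covering the complement by its single edges gives valency n − 1 − deg v ≤ n − 1 − δ, hence
-- lcc(G) + lcc(Ḡ) ≤ (δ + 1) + (n − 1 − δ) = n.
module Submission where

open import Defs
open import Data.Bool using (Bool; true; false; not; _∧_; _∨_; T; if_then_else_)
open import Data.Bool.Properties using (T-≡)
open import Data.Empty using (⊥; ⊥-elim)
open import Data.Fin using (Fin; zero; suc; toℕ; _≟_)
open import Data.Fin.Properties using (toℕ-injective)
open import Data.Fin.Subset using (Subset; _∈_; ∣_∣)
open import Data.Fin.Subset.Properties using (_∈?_)
open import Data.List using (List; []; _∷_; _++_; [_]; concat; length; filter; allFin)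
import Data.List as List
open import Data.List.Extrema.Nat using (argmin; f[argmin]≤f[xs])
open import Data.List.Membership.Propositional.Properties using (∈-allFin)
open import Data.List.Properties using (filter-++; length-++)
open import Data.List.Relation.Unary.All using (All; []; _∷_)
import Data.List.Relation.Unary.All as All
import Data.List.Relation.Unary.All.Properties as All
open import Data.List.Relation.Unary.Any using (Any; here; there)
import Data.List.Relation.Unary.Any as Any
import Data.List.Relation.Unary.Any.Properties as Any
open import Data.Nat using (ℕ; zero; suc; _+_; _*_; _∸_; _≤_; _<_; z≤n; s≤s; _<ᵇ_)
open import Data.Nat.Properties hiding (_≟_)
open import Algebra.Properties.Semiring.Sum +-*-semiring
  using (sum; ∑-distrib-+; sum-cong-≗; sum-replicate-zero; *-distribˡ-sum)
open import Data.Product using (_×_; _,_; proj₁; proj₂)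
import Data.Product as Product
open import Data.Sum using (_⊎_; inj₁; inj₂)
import Data.Sum as Sum
open import Data.Unit using (tt)
open import Data.Vec using (tabulate)
open import Data.Vec.Properties using (lookup∘tabulate; []=⇒lookup; lookup⇒[]=)
open import Function using (_∘_; Equivalence)
open import Relation.Binary.Definitions using (tri<; tri≈; tri>)
open import Relation.Binary.PropositionalEquality
  using (_≡_; _≢_; refl; sym; trans; cong; cong₂; subst; module ≡-Reasoning)
open import Relation.Nullary using (¬_; does; yes; no)
open import Relation.Nullary.Decidable using (⌊_⌋; fromWitness; dec-true; dec-false; decidable-stable)
open import Relation.Nullary.Decidable.Core using (T?)

T-∧⁺ : ∀ a {b} → T a → T b → T (a ∧ b)
T-∧⁺ true _ tb = tb

T-∧⁻ : ∀ a {b} → T (a ∧ b) → T a × T b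
T-∧⁻ true tb = tt , tb

T-∨⁺ˡ : ∀ a {b} → T a → T (a ∨ b)
T-∨⁺ˡ true _ = tt

T-∨⁺ʳ : ∀ a {b} → T b → T (a ∨ b)
T-∨⁺ʳ true _ = tt
T-∨⁺ʳ false tb = tb

T-∨⁻ : ∀ a {b} → T (a ∨ b) → T a ⊎ T b
T-∨⁻ true _ = inj₁ tt
T-∨⁻ false tb = inj₂ tb

T-not⁺ : ∀ b → ¬ T b → T (not b)
T-not⁺ false _ = tt
T-not⁺ true ¬t = ¬t tt

T-not⁻ : ∀ b → T (not b) → ¬ T b
T-not⁻ false _ ()

𝟙 : Bool → ℕ
𝟙 true = 1
𝟙 false = 0

count : ∀ {n} → (Fin n → Bool) → ℕ
count p = sum (𝟙 ∘ p)

-- does rather than ⌊_⌋, so that suc u == suc v reduces to u == v.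
_==_ : ∀ {n} → Fin n → Fin n → Bool
u == v = does (u ≟ v)

==⇒≡ : ∀ {n} {u v : Fin n} → T (u == v) → u ≡ v
==⇒≡ {u = u} {v} _ with u ≟ v
... | yes u≡v = u≡v

==-refl : ∀ {n} (v : Fin n) → T (v == v)
==-refl v with v ≟ v
... | yes _ = _
... | no v≢v = v≢v refl

𝟙≤1 : ∀ b → 𝟙 b ≤ 1
𝟙≤1 true = ≤-refl
𝟙≤1 false = z≤n

𝟙-mono : ∀ {a b} → (T a → T b) → 𝟙 a ≤ 𝟙 b
𝟙-mono {false} _ = z≤n
𝟙-mono {true} {true} _ = ≤-refl
𝟙-mono {true} {false} a⇒b = ⊥-elim (a⇒b _)

𝟙-∨ : ∀ {a b} → (T a → T b → ⊥) → 𝟙 (a ∨ b) ≡ 𝟙 a + 𝟙 b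
𝟙-∨ {false} _ = refl
𝟙-∨ {true} {false} _ = refl
𝟙-∨ {true} {true} disjoint = ⊥-elim (disjoint _ _)

𝟙-∨-≤ : ∀ a b → 𝟙 (a ∨ b) ≤ 𝟙 a + 𝟙 b
𝟙-∨-≤ false b = ≤-refl
𝟙-∨-≤ true b = m≤m+n 1 (𝟙 b)

𝟙-∧ : ∀ a b → 𝟙 (a ∧ b) ≡ 𝟙 a * 𝟙 b
𝟙-∧ false b = refl
𝟙-∧ true b = sym (*-identityˡ (𝟙 b))

sum-mono-≤ : ∀ {n} {f g : Fin n → ℕ} → (∀ i → f i ≤ g i) → sum f ≤ sum g
sum-mono-≤ {zero} _ = z≤n
sum-mono-≤ {suc n} f≤g = +-mono-≤ (f≤g zero) (sum-mono-≤ (f≤g ∘ suc))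

sum-pick : ∀ {n} (v : Fin n) (g : Fin n → ℕ) → sum (λ u → 𝟙 (u == v) * g u) ≡ g v
sum-pick {suc n} zero g = trans (cong₂ _+_ (+-identityʳ (g zero)) (sum-replicate-zero n)) (+-identityʳ (g zero))
sum-pick {suc n} (suc v) g = sum-pick v (g ∘ suc)

sum-pick² : ∀ {n} (v : Fin n) (f g : Fin n → ℕ) →
            sum (λ u → sum (λ w → 𝟙 (u == v) * f w + 𝟙 (w == v) * g u)) ≡ sum f + sum g
sum-pick² v f g = begin
  sum (λ u → sum (λ w → 𝟙 (u == v) * f w + 𝟙 (w == v) * g u))
    ≡⟨ sum-cong-≗ (λ u → ∑-distrib-+ (λ w → 𝟙 (u == v) * f w) (λ w → 𝟙 (w == v) * g u)) ⟩
  sum (λ u → sum (λ w → 𝟙 (u == v) * f w) + sum (λ w → 𝟙 (w == v) * g u))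
    ≡⟨ sum-cong-≗ (λ u → cong₂ _+_ (sym (*-distribˡ-sum (𝟙 (u == v)) f))
                                   (sum-pick v (λ _ → g u))) ⟩
  sum (λ u → 𝟙 (u == v) * sum f + g u)
    ≡⟨ ∑-distrib-+ (λ u → 𝟙 (u == v) * sum f) g ⟩
  sum (λ u → 𝟙 (u == v) * sum f) + sum g
    ≡⟨ cong (_+ sum g) (sum-pick v (λ _ → sum f)) ⟩
  sum f + sum g ∎
  where open ≡-Reasoning

count-mono : ∀ {n} {p q : Fin n → Bool} → (∀ i → T (p i) → T (q i)) → count p ≤ count q
count-mono p⇒q = sum-mono-≤ (λ i → 𝟙-mono (p⇒q i))

count-∨ : ∀ {n} {p q : Fin n → Bool} → (∀ i → T (p i) → T (q i) → ⊥) →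
          count (λ i → p i ∨ q i) ≡ count p + count q
count-∨ {p = p} {q} disjoint =
  trans (sum-cong-≗ (λ i → 𝟙-∨ (disjoint i))) (∑-distrib-+ (𝟙 ∘ p) (𝟙 ∘ q))

count-== : ∀ {n} (v : Fin n) → count (_== v) ≡ 1
count-== v = trans (sum-cong-≗ (λ u → sym (*-identityʳ (𝟙 (u == v))))) (sum-pick v (λ _ → 1))

count-none : ∀ {n} {p : Fin n → Bool} → (∀ i → ¬ T (p i)) → count p ≡ 0
count-none {zero} _ = refl
count-none {suc n} {p} ¬p = cong₂ _+_ (n≤0⇒n≡0 (𝟙-mono {b = false} (¬p zero))) (count-none (¬p ∘ suc))

count≤n : ∀ {n} (p : Fin n → Bool) → count p ≤ n
count≤n {zero} p = z≤n
count≤n {suc n} p = +-mono-≤ (𝟙≤1 (p zero)) (count≤n (p ∘ suc))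

∣tabulate∣≡count : ∀ {n} (f : Fin n → Bool) → ∣ tabulate f ∣ ≡ count f
∣tabulate∣≡count {zero} f = refl
∣tabulate∣≡count {suc n} f with f zero
... | true = cong suc (∣tabulate∣≡count (f ∘ suc))
... | false = ∣tabulate∣≡count (f ∘ suc)

∈-tabulate⁻ : ∀ {n} {f : Fin n → Bool} {u} → u ∈ tabulate f → T (f u)
∈-tabulate⁻ {f = f} {u} u∈f = Equivalence.from T-≡ (trans (sym (lookup∘tabulate f u)) ([]=⇒lookup u∈f))

∈-tabulate⁺ : ∀ {n} {f : Fin n → Bool} {u} → T (f u) → u ∈ tabulate f
∈-tabulate⁺ {f = f} {u} fu = lookup⇒[]= u _ (trans (lookup∘tabulate f u) (Equivalence.to T-≡ fu))

does-∈?-tabulate : ∀ {n} (f : Fin n → Bool) v → does (v ∈? tabulate f) ≡ f v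
does-∈?-tabulate f v with f v in fv
... | true = dec-true (v ∈? tabulate f) (∈-tabulate⁺ (Equivalence.from T-≡ fv))
... | false = dec-false (v ∈? tabulate f) (λ v∈f → subst T fv (∈-tabulate⁻ v∈f))

valency-∷ : ∀ {n} (C : Subset n) 𝒞 v → valency (C ∷ 𝒞) v ≡ 𝟙 (does (v ∈? C)) + valency 𝒞 v
valency-∷ C 𝒞 v with does (v ∈? C)
... | true = refl
... | false = refl

valency-++ : ∀ {n} (𝒞 𝒟 : List (Subset n)) v → valency (𝒞 ++ 𝒟) v ≡ valency 𝒞 v + valency 𝒟 v
valency-++ 𝒞 𝒟 v = trans (cong length (filter-++ (v ∈?_) 𝒞 𝒟)) (length-++ (filter (v ∈?_) 𝒞))

valency-concat-tabulate : ∀ {m n} (g : Fin m → List (Subset n)) v →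
                          valency (concat (List.tabulate g)) v ≡ sum (λ i → valency (g i) v)
valency-concat-tabulate {zero} g v = refl
valency-concat-tabulate {suc m} g v =
  trans (valency-++ (g zero) _ v) (cong (valency (g zero) v +_) (valency-concat-tabulate (g ∘ suc) v))

valency-[tabulate] : ∀ {n} (f : Fin n → Bool) v → valency [ tabulate f ] v ≡ 𝟙 (f v)
valency-[tabulate] f v =
  trans (valency-∷ (tabulate f) [] v) (trans (+-identityʳ _) (cong 𝟙 (does-∈?-tabulate f v)))

Covered : ∀ {n} → List (Subset n) → Fin n → Fin n → Set
Covered 𝒞 u w = Any (λ C → u ∈ C × w ∈ C) 𝒞

Covered-sym : ∀ {n} {𝒞 : List (Subset n)} {u w} → Covered 𝒞 u w → Covered 𝒞 w u
Covered-sym = Any.map Product.swap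

family : ∀ {m n} → (Fin m → Bool) → (Fin m → Fin n → Bool) → List (Subset n)
family e f = concat (List.tabulate (λ i → if e i then [ tabulate (f i) ] else []))

valency-family : ∀ {m n} (e : Fin m → Bool) (f : Fin m → Fin n → Bool) v →
                 valency (family e f) v ≡ count (λ i → e i ∧ f i v)
valency-family e f v =
  trans (valency-concat-tabulate (λ i → if e i then [ tabulate (f i) ] else []) v) (sum-cong-≗ member)
  where
  member : ∀ i → valency (if e i then [ tabulate (f i) ] else []) v ≡ 𝟙 (e i ∧ f i v)
  member i with e i
  ... | true = valency-[tabulate] (f i) v
  ... | false = refl

family-all : ∀ {m n} {P : Subset n → Set} {e : Fin m → Bool} {f : Fin m → Fin n → Bool} →
             (∀ i → T (e i) → P (tabulate (f i))) → All P (family e f)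
family-all {P = P} {e} {f} Pf = All.concat⁺ (All.tabulate⁺ (λ i → selected (e i) (Pf i)))
  where
  selected : ∀ b {C} → (T b → P C) → All P (if b then [ C ] else [])
  selected true PC = PC tt ∷ []
  selected false _ = []

family-any : ∀ {m n} {P : Subset n → Set} {e : Fin m → Bool} {f : Fin m → Fin n → Bool} i →
             T (e i) → P (tabulate (f i)) → Any P (family e f)
family-any {P = P} {e} {f} i ei Pfi = Any.concat⁺ (Any.tabulate⁺ i (selected (e i) ei))
  where
  selected : ∀ b → T b → Any P (if b then [ tabulate (f i) ] else [])
  selected true _ = here Pfi

Adj-sym : ∀ {n} (G : Graph n) {u v} → Adj G u v → Adj G v u
Adj-sym G {u} {v} = subst T (adj-sym G u v)

Adj-irrefl : ∀ {n} (G : Graph n) v → ¬ Adj G v v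
Adj-irrefl G v = subst T (adj-irrefl G v)

==⇒¬Adj : ∀ {n} (G : Graph n) {v} z → T (z == v) → ¬ Adj G v z
==⇒¬Adj G {v} z z=v with refl ← ==⇒≡ {u = z} {v} z=v = Adj-irrefl G z

degree : ∀ {n} → Graph n → Fin n → ℕ
degree G v = count (adj G v)

module EdgeCover {n} (H : Graph n) (R : Fin n → Bool) where

  within : Fin n → Fin n → Bool
  within u w = R u ∧ R w ∧ adj H u w

  -- Each edge inside R is listed once, from its endpoint of smaller index.
  ascending : Fin n → Fin n → Bool
  ascending u w = (toℕ u <ᵇ toℕ w) ∧ within u w

  pair : Fin n → Fin n → Fin n → Bool
  pair u w z = u == z ∨ w == z

  edges : List (Subset n)
  edges = concat (List.tabulate (λ u → family (ascending u) (pair u)))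

  within-sym : ∀ {u w} → T (within u w) → T (within w u)
  within-sym {u} {w} t with T-∧⁻ (R u) t
  ... | Ru , t′ with T-∧⁻ (R w) t′
  ...   | Rw , uw = T-∧⁺ (R w) Rw (T-∧⁺ (R u) Ru (Adj-sym H uw))

  within⇒R : ∀ {u w} → T (within u w) → T (R w)
  within⇒R {u} {w} = proj₁ ∘ T-∧⁻ (R w) ∘ proj₂ ∘ T-∧⁻ (R u)

  within⇒Adj : ∀ {u w} → T (within u w) → Adj H u w
  within⇒Adj {u} {w} = proj₂ ∘ T-∧⁻ (R w) ∘ proj₂ ∘ T-∧⁻ (R u)

  ascending⇒Adj : ∀ {u w} → T (ascending u w) → Adj H u w
  ascending⇒Adj {u} {w} = within⇒Adj ∘ proj₂ ∘ T-∧⁻ (toℕ u <ᵇ toℕ w)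

  ∈-pair : ∀ {u w z} → z ∈ tabulate (pair u w) → u ≡ z ⊎ w ≡ z
  ∈-pair {u} = Sum.map ==⇒≡ ==⇒≡ ∘ T-∨⁻ (u == _) ∘ ∈-tabulate⁻

  pair-clique : ∀ {u w} → Adj H u w → IsClique H (tabulate (pair u w))
  pair-clique {u} {w} uw a c a∈ c∈ a≢c with ∈-pair {u} {w} a∈ | ∈-pair {u} {w} c∈
  ... | inj₁ refl | inj₁ refl = ⊥-elim (a≢c refl)
  ... | inj₁ refl | inj₂ refl = uw
  ... | inj₂ refl | inj₁ refl = Adj-sym H uw
  ... | inj₂ refl | inj₂ refl = ⊥-elim (a≢c refl)

  edges-cliques : All (IsClique H) edges
  edges-cliques = All.concat⁺ (All.tabulate⁺ λ u →
    family-all {e = ascending u} {pair u} (λ w → pair-clique ∘ ascending⇒Adj {u} {w}))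

  ascending-covered : ∀ {u w} → toℕ u < toℕ w → Adj H u w → T (R u) → T (R w) → Covered edges u w
  ascending-covered {u} {w} u<w uw Ru Rw =
    Any.concat⁺ (Any.tabulate⁺ u (family-any w asc (∈-tabulate⁺ (T-∨⁺ˡ (u == u) (==-refl u))
                                                  , ∈-tabulate⁺ (T-∨⁺ʳ (u == w) (==-refl w)))))
    where
    asc : T (ascending u w)
    asc = T-∧⁺ (toℕ u <ᵇ toℕ w) (<⇒<ᵇ u<w) (T-∧⁺ (R u) Ru (T-∧⁺ (R w) Rw uw))

  edges-cover : ∀ {u w} → Adj H u w → T (R u) → T (R w) → Covered edges u w
  edges-cover {u} {w} uw Ru Rw with <-cmp (toℕ u) (toℕ w)
  ... | tri< u<w _ _ = ascending-covered u<w uw Ru Rw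
  ... | tri≈ _ u≡w _ = ⊥-elim (Adj-irrefl H w (subst (λ a → Adj H a w) (toℕ-injective u≡w) uw))
  ... | tri> _ _ w<u = Covered-sym (ascending-covered w<u (Adj-sym H uw) Rw Ru)

  ascending-at : ∀ u w v → T (ascending u w ∧ pair u w v) →
                 T ((u == v ∧ ascending v w) ∨ (w == v ∧ ascending u v))
  ascending-at u w v t with T-∧⁻ (ascending u w) t
  ... | asc , at with T-∨⁻ (u == v) at
  ...   | inj₁ u=v with refl ← ==⇒≡ {u = u} {v} u=v =
    T-∨⁺ˡ (u == u ∧ ascending u w) (T-∧⁺ (u == u) u=v asc)
  ...   | inj₂ w=v with refl ← ==⇒≡ {u = w} {v} w=v =
    T-∨⁺ʳ (u == w ∧ ascending w w) (T-∧⁺ (w == w) w=v asc)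

  𝟙-ascending-at : ∀ u w v → 𝟙 (ascending u w ∧ pair u w v) ≤
                   𝟙 (u == v) * 𝟙 (ascending v w) + 𝟙 (w == v) * 𝟙 (ascending u v)
  𝟙-ascending-at u w v = begin
    𝟙 (ascending u w ∧ pair u w v)
      ≤⟨ 𝟙-mono (ascending-at u w v) ⟩
    𝟙 ((u == v ∧ ascending v w) ∨ (w == v ∧ ascending u v))
      ≤⟨ 𝟙-∨-≤ (u == v ∧ ascending v w) _ ⟩
    𝟙 (u == v ∧ ascending v w) + 𝟙 (w == v ∧ ascending u v)
      ≡⟨ cong₂ _+_ (𝟙-∧ (u == v) _) (𝟙-∧ (w == v) _) ⟩
    𝟙 (u == v) * 𝟙 (ascending v w) + 𝟙 (w == v) * 𝟙 (ascending u v) ∎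
    where open ≤-Reasoning

  ascending-asym : ∀ {u w} → T (ascending u w) → T (ascending w u) → ⊥
  ascending-asym {u} {w} uw wu =
    <-asym (<ᵇ⇒< (toℕ u) _ (proj₁ (T-∧⁻ (toℕ u <ᵇ toℕ w) uw)))
           (<ᵇ⇒< (toℕ w) _ (proj₁ (T-∧⁻ (toℕ w <ᵇ toℕ u) wu)))

  valency-edges : ∀ v → valency edges v ≤ count (within v)
  valency-edges v = begin
    valency edges v
      ≡⟨ valency-concat-tabulate (λ u → family (ascending u) (pair u)) v ⟩
    sum (λ u → valency (family (ascending u) (pair u)) v)
      ≡⟨ sum-cong-≗ (λ u → valency-family (ascending u) (pair u) v) ⟩
    sum (λ u → count (λ w → ascending u w ∧ pair u w v))
      ≤⟨ sum-mono-≤ (λ u → sum-mono-≤ (λ w → 𝟙-ascending-at u w v)) ⟩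
    sum (λ u → sum (λ w → 𝟙 (u == v) * 𝟙 (ascending v w) + 𝟙 (w == v) * 𝟙 (ascending u v)))
      ≡⟨ sum-pick² v (𝟙 ∘ ascending v) (λ u → 𝟙 (ascending u v)) ⟩
    count (ascending v) + count (λ u → ascending u v)
      ≡⟨ count-∨ (λ z → ascending-asym {v} {z}) ⟨
    count (λ z → ascending v z ∨ ascending z v)
      ≤⟨ count-mono (λ z → Sum.[ proj₂ ∘ T-∧⁻ (toℕ v <ᵇ toℕ z)
                               , within-sym {z} ∘ proj₂ ∘ T-∧⁻ (toℕ z <ᵇ toℕ v) ] ∘ T-∨⁻ (ascending v z)) ⟩
    count (within v) ∎
    where open ≤-Reasoning

no-independent-triple : ∀ {n} (G : Graph n) → (∀ S → IsIndependent G S → ∣ S ∣ ≤ 2) →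
                        ∀ {x u w} → x ≢ u → x ≢ w → u ≢ w →
                        ¬ Adj G x u → ¬ Adj G x w → ¬ Adj G u w → ⊥
no-independent-triple {n} G α≤2 {x} {u} {w} x≢u x≢w u≢w ¬xu ¬xw ¬uw =
  <⇒≱ (n<1+n 2) (subst (_≤ 2) size (α≤2 (tabulate triple) independent))
  where
  triple : Fin n → Bool
  triple z = z == x ∨ (z == u ∨ z == w)

  size : ∣ tabulate triple ∣ ≡ 3
  size = begin
    ∣ tabulate triple ∣
      ≡⟨ ∣tabulate∣≡count triple ⟩
    count triple
      ≡⟨ count-∨ distinct-x ⟩
    count (_== x) + count (λ z → z == u ∨ z == w)
      ≡⟨ cong (count (_== x) +_) (count-∨ distinct-uw) ⟩
    count (_== x) + (count (_== u) + count (_== w))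
      ≡⟨ cong₂ _+_ (count-== x) (cong₂ _+_ (count-== u) (count-== w)) ⟩
    3 ∎
    where
    open ≡-Reasoning
    distinct-uw : ∀ z → T (z == u) → T (z == w) → ⊥
    distinct-uw z zu zw with refl ← ==⇒≡ {u = z} {u} zu = u≢w (==⇒≡ zw)
    distinct-x : ∀ z → T (z == x) → T (z == u ∨ z == w) → ⊥
    distinct-x z zx zu∨zw with refl ← ==⇒≡ {u = z} {x} zx with T-∨⁻ (z == u) zu∨zw
    ... | inj₁ zu = x≢u (==⇒≡ zu)
    ... | inj₂ zw = x≢w (==⇒≡ zw)

  member : ∀ {a} → a ∈ tabulate triple → a ≡ x ⊎ a ≡ u ⊎ a ≡ w
  member {a} = Sum.map (==⇒≡ {u = a}) (Sum.map (==⇒≡ {u = a}) (==⇒≡ {u = a}) ∘ T-∨⁻ (a == u))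
             ∘ T-∨⁻ (a == x) ∘ ∈-tabulate⁻

  independent : IsIndependent G (tabulate triple)
  independent a c a∈ c∈ with member a∈ | member c∈
  ... | inj₁ refl        | inj₁ refl        = Adj-irrefl G a
  ... | inj₁ refl        | inj₂ (inj₁ refl) = ¬xu
  ... | inj₁ refl        | inj₂ (inj₂ refl) = ¬xw
  ... | inj₂ (inj₁ refl) | inj₁ refl        = ¬xu ∘ Adj-sym G
  ... | inj₂ (inj₁ refl) | inj₂ (inj₁ refl) = Adj-irrefl G a
  ... | inj₂ (inj₁ refl) | inj₂ (inj₂ refl) = ¬uw
  ... | inj₂ (inj₂ refl) | inj₁ refl        = ¬xw ∘ Adj-sym G
  ... | inj₂ (inj₂ refl) | inj₂ (inj₁ refl) = ¬uw ∘ Adj-sym G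
  ... | inj₂ (inj₂ refl) | inj₂ (inj₂ refl) = Adj-irrefl G a

module ClosedNeighbourhoodCover {n} (G : Graph n) (α≤2 : ∀ S → IsIndependent G S → ∣ S ∣ ≤ 2) (x : Fin n)
  where

  closed : Fin n → Bool
  closed z = z == x ∨ adj G x z

  far : Fin n → Bool
  far z = not (closed z)

  open EdgeCover G closed using (edges; within; within⇒R; within⇒Adj; edges-cliques; edges-cover; valency-edges)

  far⇒≢ : ∀ {u} → T (far u) → u ≢ x
  far⇒≢ {u} fu refl = T-not⁻ (closed u) fu (T-∨⁺ˡ (u == u) (==-refl u))

  far⇒¬Adj : ∀ {u} → T (far u) → ¬ Adj G x u
  far⇒¬Adj {u} fu xu = T-not⁻ (closed u) fu (T-∨⁺ʳ (u == x) xu)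

  far-clique : IsClique G (tabulate far)
  far-clique u w u∈ w∈ u≢w = decidable-stable (T? (adj G u w)) λ ¬uw →
    no-independent-triple G α≤2 (far⇒≢ fu ∘ sym) (far⇒≢ fw ∘ sym) u≢w
                                (far⇒¬Adj fu) (far⇒¬Adj fw) ¬uw
    where
    fu : T (far u)
    fu = ∈-tabulate⁻ u∈
    fw : T (far w)
    fw = ∈-tabulate⁻ w∈

  star : Fin n → Fin n → Bool
  star b z = b == z ∨ (far z ∧ adj G b z)

  ∈-star : ∀ {b z} → z ∈ tabulate (star b) → b ≡ z ⊎ T (far z) × Adj G b z
  ∈-star {b} {z} = Sum.map (==⇒≡ {u = b}) (T-∧⁻ (far z)) ∘ T-∨⁻ (b == z) ∘ ∈-tabulate⁻

  star-clique : ∀ b → IsClique G (tabulate (star b))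
  star-clique b a c a∈ c∈ a≢c with ∈-star a∈ | ∈-star c∈
  ... | inj₁ refl      | inj₁ refl      = ⊥-elim (a≢c refl)
  ... | inj₁ refl      | inj₂ (_ , bc)  = bc
  ... | inj₂ (_ , ba)  | inj₁ refl      = Adj-sym G ba
  ... | inj₂ (fa , _)  | inj₂ (fc , _)  = far-clique a c (∈-tabulate⁺ fa) (∈-tabulate⁺ fc) a≢c

  stars : List (Subset n)
  stars = family (adj G x) star

  stars-cover : ∀ {u w} → Adj G u w → T (closed u) → T (far w) → Covered stars u w
  stars-cover {u} {w} uw cu fw with T-∨⁻ (u == x) cu
  ... | inj₁ u=x with refl ← ==⇒≡ {u = u} {x} u=x = ⊥-elim (far⇒¬Adj fw uw)
  ... | inj₂ xu = family-any u xu ( ∈-tabulate⁺ (T-∨⁺ˡ (u == u) (==-refl u))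
                                  , ∈-tabulate⁺ (T-∨⁺ʳ (u == w) (T-∧⁺ (far w) fw uw)))

  cover : List (Subset n)
  cover = tabulate far ∷ (stars ++ edges)

  cover-cliques : All (IsClique G) cover
  cover-cliques = far-clique ∷ All.++⁺ (family-all (λ b _ → star-clique b)) edges-cliques

  cover-covers : ∀ {u w} → Adj G u w → Covered cover u w
  cover-covers {u} {w} uw with T? (closed u) | T? (closed w)
  ... | yes cu | yes cw = there (Any.++⁺ʳ stars (edges-cover uw cu cw))
  ... | yes cu | no ¬cw = there (Any.++⁺ˡ (stars-cover uw cu (T-not⁺ (closed w) ¬cw)))
  ... | no ¬cu | yes cw = Covered-sym (there (Any.++⁺ˡ (stars-cover (Adj-sym G uw) cw (T-not⁺ (closed u) ¬cu))))
  ... | no ¬cu | no ¬cw = here (∈-tabulate⁺ (T-not⁺ (closed u) ¬cu) , ∈-tabulate⁺ (T-not⁺ (closed w) ¬cw))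

  valency-cover-split : ∀ v → valency cover v ≡
                        𝟙 (far v) + (count (λ b → adj G x b ∧ star b v) + valency edges v)
  valency-cover-split v = begin
    valency cover v
      ≡⟨ valency-∷ (tabulate far) (stars ++ edges) v ⟩
    𝟙 (does (v ∈? tabulate far)) + valency (stars ++ edges) v
      ≡⟨ cong₂ _+_ (cong 𝟙 (does-∈?-tabulate far v)) (valency-++ stars edges v) ⟩
    𝟙 (far v) + (valency stars v + valency edges v)
      ≡⟨ cong (λ k → 𝟙 (far v) + (k + valency edges v)) (valency-family (adj G x) star v) ⟩
    𝟙 (far v) + (count (λ b → adj G x b ∧ star b v) + valency edges v) ∎
    where open ≡-Reasoning

  count-closed : count closed ≡ suc (degree G x)
  count-closed = trans (count-∨ (==⇒¬Adj G)) (cong (_+ degree G x) (count-== x))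

  valency-cover-far : ∀ {v} → ¬ T (closed v) → valency cover v ≤ suc (degree G x)
  valency-cover-far {v} ¬cv = begin
    valency cover v
      ≡⟨ valency-cover-split v ⟩
    𝟙 (far v) + (count (λ b → adj G x b ∧ star b v) + valency edges v)
      ≤⟨ +-mono-≤ (𝟙≤1 (far v)) (+-mono-≤ (count-mono (λ b → proj₁ ∘ T-∧⁻ (adj G x b)))
                                          (valency-edges v)) ⟩
    1 + (degree G x + count (within v))
      ≡⟨ cong (λ k → suc (degree G x + k))
              (count-none {p = within v} (λ z → ¬cv ∘ proj₁ ∘ T-∧⁻ (closed v))) ⟩
    1 + (degree G x + 0)
      ≡⟨ cong suc (+-identityʳ (degree G x)) ⟩
    suc (degree G x) ∎
    where open ≤-Reasoning

  valency-cover-closed : ∀ {v} → T (closed v) → valency cover v ≤ suc (degree G x)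
  valency-cover-closed {v} cv = begin
    valency cover v
      ≡⟨ valency-cover-split v ⟩
    𝟙 (far v) + (count (λ b → adj G x b ∧ star b v) + valency edges v)
      ≤⟨ +-mono-≤ (𝟙-mono {b = false} (λ fv → T-not⁻ (closed v) fv cv))
                  (+-mono-≤ (count-mono only-own-star) (valency-edges v)) ⟩
    count (_== v) + count (within v)
      ≡⟨ count-∨ (λ z z=v → ==⇒¬Adj G z z=v ∘ within⇒Adj {v}) ⟨
    count (λ z → z == v ∨ within v z)
      ≤⟨ count-mono (λ z → Sum.[ closed-self z , within⇒R {v} ] ∘ T-∨⁻ (z == v)) ⟩
    count closed
      ≡⟨ count-closed ⟩
    suc (degree G x) ∎
    where
    open ≤-Reasoning
    closed-self : ∀ z → T (z == v) → T (closed z)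
    closed-self z z=v with refl ← ==⇒≡ {u = z} {v} z=v = cv
    only-own-star : ∀ b → T (adj G x b ∧ star b v) → T (b == v)
    only-own-star b t with T-∨⁻ (b == v) (proj₂ (T-∧⁻ (adj G x b) t))
    ... | inj₁ b=v = b=v
    ... | inj₂ fv = ⊥-elim (T-not⁻ (closed v) (proj₁ (T-∧⁻ (far v) fv)) cv)

  valency-cover : ∀ v → valency cover v ≤ suc (degree G x)
  valency-cover v with T? (closed v)
  ... | yes cv = valency-cover-closed cv
  ... | no ¬cv = valency-cover-far ¬cv

  cover-bound : LocalCoverBound G (suc (degree G x))
  cover-bound = cover , (cover-cliques , λ _ _ → cover-covers) , valency-cover

degree-complement : ∀ {n} (G : Graph n) v → degree (complement G) v + suc (degree G v) ≤ n
degree-complement {n} G v = begin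
  degree (complement G) v + suc (degree G v)
    ≡⟨ cong (λ k → degree (complement G) v + (k + degree G v)) (count-== v) ⟨
  count (adj (complement G) v) + (count (_== v) + count (adj G v))
    ≡⟨ cong (count (adj (complement G) v) +_) (count-∨ (==⇒¬Adj G)) ⟨
  count (adj (complement G) v) + count (λ z → z == v ∨ adj G v z)
    ≡⟨ count-∨ non-edge ⟨
  count (λ z → adj (complement G) v z ∨ (z == v ∨ adj G v z))
    ≤⟨ count≤n _ ⟩
  n ∎
  where
  open ≤-Reasoning
  non-edge : ∀ z → Adj (complement G) v z → T (z == v ∨ adj G v z) → ⊥
  non-edge z vz with T-∧⁻ (not (adj G v z)) vz
  ... | ¬vz , v≢z = Sum.[ (λ z=v → T-not⁻ ⌊ v ≟ z ⌋ v≢z (fromWitness (sym (==⇒≡ {u = z} z=v))))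
                        , T-not⁻ (adj G v z) ¬vz ] ∘ T-∨⁻ (z == v)

complement-cover-bound : ∀ {n} (G : Graph n) δ → (∀ v → δ ≤ degree G v) →
                         LocalCoverBound (complement G) (n ∸ suc δ)
complement-cover-bound {n} G δ δ≤degree = edges , (edges-cliques , λ _ _ uw → edges-cover uw tt tt) , bounded
  where
  open EdgeCover (complement G) (λ _ → true)
  bounded : ∀ v → valency edges v ≤ n ∸ suc δ
  bounded v = ≤-trans (valency-edges v)
    (m+n≤o⇒m≤o∸n _ (≤-trans (+-monoʳ-≤ _ (s≤s (δ≤degree v))) (degree-complement G v)))

theorem5 : (n : ℕ) (G : Graph n) → IndependenceNumber G 2 →
           (k₁ k₂ : ℕ) → IsLCC G k₁ → IsLCC (complement G) k₂ → k₁ + k₂ ≤ n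
theorem5 zero G _ k₁ k₂ (_ , k₁-least) (_ , k₂-least) =
  +-mono-≤ (k₁-least 0 (empty-cover {G})) (k₂-least 0 (empty-cover {complement G}))
  where
  empty-cover : ∀ {H : Graph 0} → LocalCoverBound H 0
  empty-cover = [] , ([] , λ ()) , λ ()
theorem5 n@(suc _) G (_ , α≤2) k₁ k₂ (_ , k₁-least) (_ , k₂-least) = begin
  k₁ + k₂
    ≤⟨ +-mono-≤ (k₁-least _ (cover-bound G α≤2 x)) (k₂-least (n ∸ suc δ) (complement-cover-bound G δ x-minimal)) ⟩
  suc δ + (n ∸ suc δ)
    ≡⟨ m+[n∸m]≡n (≤-trans (m≤n+m (suc δ) (degree (complement G) x)) (degree-complement G x)) ⟩
  n ∎
  where
  open ≤-Reasoning
  open ClosedNeighbourhoodCover using (cover-bound)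
  x : Fin n
  x = argmin (degree G) zero (allFin n)
  δ : ℕ
  δ = degree G x
  x-minimal : ∀ v → δ ≤ degree G v
  x-minimal v = All.lookup (f[argmin]≤f[xs] {f = degree G} zero (allFin n)) (∈-allFin v)
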